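{- Let $\Sigma$ be a finite alphabet, $\vartheta$ a commutation relation on $\Sigma$, $B\subseteq\Sigma$ a subalphabet, and let $L\subseteq \mathbf{M}(\Sigma,\vartheta)$ be the set of traces whose terminal alphabet is a subset of $\Sigma\setminus B$. Then $L$ is a recognizable submonoid of $\mathbf{M}(\Sigma,\vartheta)$, i.e. $L$ is a submonoid and $\mathrm{Rep}(L)$ is a regular language over $\Sigma$.
   Context: A commutation relation $\vartheta$ on $\Sigma$ is a reflexive and symmetric relation. The trace monoid $\mathbf{M}(\Sigma,\vartheta)=\Sigma^*/\equiv_\vartheta$, where $\equiv_\vartheta$ is the congruence generated by $ab\equiv ba$ for $(a,b)\in\vartheta$. Let $\phi:\Sigma^*\to\mathbf{M}(\Sigma,\vartheta)$ be the natural surjection; for a set $S$ of traces, $\mathrm{Rep}(S)=\phi^{ -1}(S)$. A set of traces $S$ is called recognizable if $\mathrm{Rep}(S)$ is recognizable by a finite automaton. The terminal alphabet of a trace $w$ is $TA(w)=\{x\in\Sigma : w=ux \text{ for some } u\in\mathbf{M}(\Sigma,\vartheta)\}$. -}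

module Defs where

open import Data.Nat using (ℕ)
open import Data.Fin using (Fin)
open import Data.Bool using (Bool; true; false)
open import Data.List using (List; []; _∷_; _++_; [_]; foldl)
open import Data.Product using (∃; _×_; _,_)
open import Data.Fin.Subset using (Subset; _∈_; _∉_)
open import Relation.Binary.PropositionalEquality using (_≡_)
open import Relation.Binary.Construct.Closure.Equivalence using (EqClosure)
open import Function.Bundles using (_⇔_)

record CommRel (n : ℕ) : Set where
  field
    θ     : Fin n → Fin n → Bool
    θ-refl : ∀ a → θ a a ≡ true
    θ-sym  : ∀ a b → θ a b ≡ true → θ b a ≡ true
open CommRel public

Word : ℕ → Set
Word n = List (Fin n)

data Swap {n : ℕ} (ϑ : CommRel n) : Word n → Word n → Set where
  swap : ∀ (u v : Word n) (a b : Fin n) → θ ϑ a b ≡ true →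
         Swap ϑ (u ++ a ∷ b ∷ v) (u ++ b ∷ a ∷ v)

-- ≡_ϑ : the congruence generated by ab ≡ ba, (a,b) ∈ ϑ, i.e. the equivalence
-- closure of the contextual swaps.  Traces = words modulo this relation.
_≈[_]_ : ∀ {n} → Word n → CommRel n → Word n → Set
u ≈[ ϑ ] v = EqClosure (Swap ϑ) u v

InTA : ∀ {n : ℕ} → CommRel n → Fin n → Word n → Set
InTA {n} ϑ x w = ∃ λ (u : Word n) → w ≈[ ϑ ] (u ++ [ x ])

-- Rep(L): words whose trace has terminal alphabet ⊆ Σ ∖ B.
-- (Membership of a trace in L is defined on representatives; it is invariant
-- under ≈ by construction, so this predicate is exactly φ⁻¹(L).)
RepL : ∀ {n} → CommRel n → Subset n → Word n → Set
RepL ϑ B w = ∀ x → InTA ϑ x w → x ∉ B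

record DFA (n : ℕ) : Set where
  field
    states : ℕ
    init   : Fin states
    δ      : Fin states → Fin n → Fin states
    final  : Fin states → Bool
open DFA public

accepts : ∀ {n} → DFA n → Word n → Bool
accepts A w = final A (foldl (δ A) (init A) w)

Regular : ∀ {n} → (Word n → Set) → Set
Regular {n} K = ∃ λ (A : DFA n) → ∀ w → (accepts A w ≡ true) ⇔ K w

-- A set of traces (given by its ≈-saturated representative set K) is a
-- submonoid: contains the empty trace and is closed under trace product.
Submonoid : ∀ {n} → (Word n → Set) → Set
Submonoid {n} K = K [] × (∀ u v → K u → K v → K (u ++ v))

-- The terminal alphabet of a word can be computed by a left-to-right scan,
-- TA(w a) = {a} ∪ {x ∈ TA(w) | (x, a) ∈ ϑ}.  Two updates by commuting letters
-- commute, so the scan is constant on traces, and it computes TA exactly.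
-- Its states are subsets of Σ, so testing TA(w) ⊆ Σ ∖ B is a finite automaton;
-- and TA(u v) ⊆ TA(u) ∪ TA(v) makes L closed under product.
module Submission where

open import Defs
open import Data.Nat using (ℕ; _^_)
open import Data.Fin using (Fin; funToFin; finToFun)
open import Data.Fin.Properties using (2↔Bool; finToFun-funToFin)
open import Data.Fin.Subset using (Subset; ⊥; ⁅_⁆; _∪_; _∩_; ∁; _∈_; _⊆_)
open import Data.Fin.Subset.Properties
  using (∉⊥; x∈⁅x⁆; x∈⁅y⁆⇒x≡y; x∈p∪q⁺; x∈p∪q⁻; x∈p∩q⁺; x∈p∩q⁻; ⊆-antisym; _⊆?_; x∉p⇒x∈∁p; x∈∁p⇒x∉p)
open import Data.Bool using (true)
open import Data.List using ([]; _∷_; _++_; [_]; _∷ʳ_; foldl)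
open import Data.List.Properties using (foldl-++; foldl-∷ʳ; ++-assoc)
open import Data.List.Reverse using (Reverse; reverseView; []; _∶_∶ʳ_)
open import Data.Vec using (lookup; tabulate)
open import Data.Vec.Properties using (lookup∘tabulate; tabulate∘lookup; tabulate-cong; []=⇒lookup; lookup⇒[]=)
open import Data.Product using (_×_; _,_)
open import Data.Sum using (_⊎_; inj₁; inj₂)
open import Function using (_∘_)
open import Function.Bundles using (_⇔_; mk⇔; Inverse; Equivalence)
import Function.Properties.Equivalence as ⇔
open import Relation.Nullary using (does; yes; no; contradiction)
open import Relation.Unary using (Decidable)
open import Relation.Binary.PropositionalEquality
  using (_≡_; refl; sym; trans; cong; isEquivalence; module ≡-Reasoning)
open import Relation.Binary.Construct.Closure.ReflexiveTransitive using (ε; _◅_; _◅◅_)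
open import Relation.Binary.Construct.Closure.Symmetric using (fwd)
import Relation.Binary.Construct.Closure.Equivalence as EqClosure

regular-viaRetraction : ∀ {n} {S : Set} (k : ℕ) (encode : S → Fin k) (decode : Fin k → S) →
  (∀ s → decode (encode s) ≡ s) →
  (s₀ : S) (step : S → Fin n → S) {P : S → Set} (P? : Decidable P) {K : Word n → Set} →
  (∀ w → P (foldl step s₀ w) ⇔ K w) → Regular K
regular-viaRetraction k encode decode decode-encode s₀ step {P} P? correct =
  A , λ w → ⇔.trans (accepts⇔P w) (correct w)
  where
  A : DFA _
  A = record { states = k ; init = encode s₀
             ; δ = λ i a → encode (step (decode i) a) ; final = does ∘ P? ∘ decode }

  run : ∀ s w → foldl (δ A) (encode s) w ≡ encode (foldl step s w)
  run s []      = refl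
  run s (a ∷ w) rewrite decode-encode s = run (step s a) w

  accepts⇔P : ∀ w → (accepts A w ≡ true) ⇔ P (foldl step s₀ w)
  accepts⇔P w rewrite run s₀ w | decode-encode (foldl step s₀ w) = does⇔ (foldl step s₀ w)
    where
    does⇔ : ∀ s → (does (P? s) ≡ true) ⇔ P s
    does⇔ s with P? s
    ... | yes p  = mk⇔ (λ _ → p) (λ _ → refl)
    ... | no ¬p  = mk⇔ (λ ()) (λ p → contradiction p ¬p)

subsetToFin : ∀ {m} → Subset m → Fin (2 ^ m)
subsetToFin S = funToFin (Inverse.from 2↔Bool ∘ lookup S)

finToSubset : ∀ {m} → Fin (2 ^ m) → Subset m
finToSubset i = tabulate (Inverse.to 2↔Bool ∘ finToFun i)

finToSubset-subsetToFin : ∀ {m} (S : Subset m) → finToSubset (subsetToFin S) ≡ S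
finToSubset-subsetToFin S = begin
  tabulate (Inverse.to 2↔Bool ∘ finToFun (subsetToFin S))
    ≡⟨ tabulate-cong pointwise ⟩
  tabulate (lookup S)
    ≡⟨ tabulate∘lookup S ⟩
  S ∎
  where
  open ≡-Reasoning
  pointwise : ∀ x → Inverse.to 2↔Bool (finToFun (subsetToFin S) x) ≡ lookup S x
  pointwise x = trans (cong (Inverse.to 2↔Bool) (finToFun-funToFin _ x))
                      (Inverse.strictlyInverseˡ 2↔Bool (lookup S x))

regular-viaSubsetAutomaton : ∀ {n m} (s₀ : Subset m) (step : Subset m → Fin n → Subset m) →
  {P : Subset m → Set} (P? : Decidable P) {K : Word n → Set} →
  (∀ w → P (foldl step s₀ w) ⇔ K w) → Regular K
regular-viaSubsetAutomaton {m = m} =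
  regular-viaRetraction (2 ^ m) subsetToFin finToSubset finToSubset-subsetToFin

module _ {n : ℕ} (ϑ : CommRel n) where

  infix 4 _≈_
  _≈_ : Word n → Word n → Set
  u ≈ v = u ≈[ ϑ ] v

  swap-++ʳ : ∀ c {u v} → Swap ϑ u v → Swap ϑ (u ++ c) (v ++ c)
  swap-++ʳ c (swap u v a b p) rewrite ++-assoc u (a ∷ b ∷ v) c | ++-assoc u (b ∷ a ∷ v) c =
    swap u (v ++ c) a b p

  ≈-++ʳ : ∀ c {u v} → u ≈ v → u ++ c ≈ v ++ c
  ≈-++ʳ c = EqClosure.gmap (_++ c) (swap-++ʳ c)

  swap-last : ∀ u {x a} → θ ϑ x a ≡ true → (u ∷ʳ x) ∷ʳ a ≈ (u ∷ʳ a) ∷ʳ x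
  swap-last u {x} {a} p rewrite ++-assoc u [ x ] [ a ] | ++-assoc u [ a ] [ x ] =
    fwd (swap u [] x a p) ◅ ε

  commutesWith : Fin n → Subset n
  commutesWith a = tabulate (λ x → θ ϑ x a)

  ∈-commutesWith : ∀ {x a} → x ∈ commutesWith a ⇔ θ ϑ x a ≡ true
  ∈-commutesWith {x} {a} = mk⇔
    (λ x∈ → trans (sym (lookup∘tabulate _ x)) ([]=⇒lookup x∈))
    (λ p → lookup⇒[]= x _ (trans (lookup∘tabulate _ x) p))

  appendTerminal : Subset n → Fin n → Subset n
  appendTerminal S a = ⁅ a ⁆ ∪ (S ∩ commutesWith a)

  terminalAlphabet : Word n → Subset n
  terminalAlphabet = foldl appendTerminal ⊥

  ∈-appendTerminal⁻ : ∀ {S a x} → x ∈ appendTerminal S a → x ≡ a ⊎ (x ∈ S × θ ϑ x a ≡ true)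
  ∈-appendTerminal⁻ {S} {a} x∈ with x∈p∪q⁻ ⁅ a ⁆ _ x∈
  ... | inj₁ x∈⁅a⁆ = inj₁ (x∈⁅y⁆⇒x≡y a x∈⁅a⁆)
  ... | inj₂ x∈∩   = let (x∈S , x∈ϑa) = x∈p∩q⁻ S _ x∈∩ in
                     inj₂ (x∈S , Equivalence.to ∈-commutesWith x∈ϑa)

  a∈appendTerminal : ∀ S a → a ∈ appendTerminal S a
  a∈appendTerminal S a = x∈p∪q⁺ (inj₁ (x∈⁅x⁆ a))

  ∈-appendTerminal⁺ : ∀ {S a x} → x ∈ S → θ ϑ x a ≡ true → x ∈ appendTerminal S a
  ∈-appendTerminal⁺ x∈S p = x∈p∪q⁺ (inj₂ (x∈p∩q⁺ (x∈S , Equivalence.from ∈-commutesWith p)))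

  appendTerminal-swap-⊆ : ∀ S {a b} → θ ϑ a b ≡ true →
    appendTerminal (appendTerminal S a) b ⊆ appendTerminal (appendTerminal S b) a
  appendTerminal-swap-⊆ S {a} {b} ab x∈ with ∈-appendTerminal⁻ x∈
  ... | inj₁ refl = ∈-appendTerminal⁺ (a∈appendTerminal S b) (θ-sym ϑ a b ab)
  ... | inj₂ (x∈Sa , xb) with ∈-appendTerminal⁻ x∈Sa
  ...   | inj₁ refl       = a∈appendTerminal _ a
  ...   | inj₂ (x∈S , xa) = ∈-appendTerminal⁺ (∈-appendTerminal⁺ x∈S xb) xa

  appendTerminal-comm : ∀ S {a b} → θ ϑ a b ≡ true →
    appendTerminal (appendTerminal S a) b ≡ appendTerminal (appendTerminal S b) a
  appendTerminal-comm S ab =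
    ⊆-antisym (appendTerminal-swap-⊆ S ab) (appendTerminal-swap-⊆ S (θ-sym ϑ _ _ ab))

  terminalAlphabet-swap : ∀ {u v} → Swap ϑ u v → terminalAlphabet u ≡ terminalAlphabet v
  terminalAlphabet-swap (swap u v a b ab) = begin
    terminalAlphabet (u ++ a ∷ b ∷ v)
      ≡⟨ foldl-++ appendTerminal ⊥ u (a ∷ b ∷ v) ⟩
    foldl appendTerminal (appendTerminal (appendTerminal (terminalAlphabet u) a) b) v
      ≡⟨ cong (λ S → foldl appendTerminal S v) (appendTerminal-comm (terminalAlphabet u) ab) ⟩
    foldl appendTerminal (appendTerminal (appendTerminal (terminalAlphabet u) b) a) v
      ≡⟨ foldl-++ appendTerminal ⊥ u (b ∷ a ∷ v) ⟨
    terminalAlphabet (u ++ b ∷ a ∷ v) ∎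
    where open ≡-Reasoning

  terminalAlphabet-≈ : ∀ {u v} → u ≈ v → terminalAlphabet u ≡ terminalAlphabet v
  terminalAlphabet-≈ = EqClosure.gfold isEquivalence terminalAlphabet terminalAlphabet-swap

  terminalAlphabet-∷ʳ : ∀ w a → terminalAlphabet (w ∷ʳ a) ≡ appendTerminal (terminalAlphabet w) a
  terminalAlphabet-∷ʳ w a = foldl-∷ʳ appendTerminal ⊥ a w

  InTA⇒∈ : ∀ {x w} → InTA ϑ x w → x ∈ terminalAlphabet w
  InTA⇒∈ {x} {w} (u , w≈ux) rewrite terminalAlphabet-≈ w≈ux | terminalAlphabet-∷ʳ u x =
    a∈appendTerminal (terminalAlphabet u) x

  ∈⇒InTA : ∀ {x w} → Reverse w → x ∈ terminalAlphabet w → InTA ϑ x w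
  ∈⇒InTA [] x∈ with () ← ∉⊥ x∈
  ∈⇒InTA (v ∶ r ∶ʳ a) x∈ rewrite terminalAlphabet-∷ʳ v a with ∈-appendTerminal⁻ x∈
  ... | inj₁ refl = v , ε
  ... | inj₂ (x∈v , xa) =
    let (u , v≈ux) = ∈⇒InTA r x∈v in
    u ∷ʳ a , ≈-++ʳ [ a ] v≈ux ◅◅ swap-last u xa

  InTA⇔∈ : ∀ {x w} → InTA ϑ x w ⇔ x ∈ terminalAlphabet w
  InTA⇔∈ {w = w} = mk⇔ InTA⇒∈ (∈⇒InTA (reverseView w))

  foldl-appendTerminal-⊆ : ∀ S {v} → Reverse v → foldl appendTerminal S v ⊆ S ∪ terminalAlphabet v
  foldl-appendTerminal-⊆ S [] x∈ = x∈p∪q⁺ (inj₁ x∈)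
  foldl-appendTerminal-⊆ S (v ∶ r ∶ʳ a) x∈
    rewrite foldl-∷ʳ appendTerminal S a v | terminalAlphabet-∷ʳ v a with ∈-appendTerminal⁻ x∈
  ... | inj₁ refl = x∈p∪q⁺ (inj₂ (a∈appendTerminal _ a))
  ... | inj₂ (x∈Sv , xa) with x∈p∪q⁻ S _ (foldl-appendTerminal-⊆ S r x∈Sv)
  ...   | inj₁ x∈S = x∈p∪q⁺ (inj₁ x∈S)
  ...   | inj₂ x∈v = x∈p∪q⁺ (inj₂ (∈-appendTerminal⁺ x∈v xa))

  terminalAlphabet-++ : ∀ u v → terminalAlphabet (u ++ v) ⊆ terminalAlphabet u ∪ terminalAlphabet v
  terminalAlphabet-++ u v x∈ rewrite foldl-++ appendTerminal ⊥ u v =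
    foldl-appendTerminal-⊆ (terminalAlphabet u) (reverseView v) x∈

  module _ (B : Subset n) where

    RepL⇔⊆∁ : ∀ w → terminalAlphabet w ⊆ ∁ B ⇔ RepL ϑ B w
    RepL⇔⊆∁ w = mk⇔
      (λ TA⊆ x x∈TA → x∈∁p⇒x∉p (TA⊆ (Equivalence.to InTA⇔∈ x∈TA)))
      (λ repL {x} x∈TA → x∉p⇒x∈∁p (repL x (Equivalence.from InTA⇔∈ x∈TA)))

    RepL-[] : RepL ϑ B []
    RepL-[] x x∈TA with () ← ∉⊥ (Equivalence.to InTA⇔∈ x∈TA)

    RepL-++ : ∀ u v → RepL ϑ B u → RepL ϑ B v → RepL ϑ B (u ++ v)
    RepL-++ u v repL-u repL-v x x∈TA
      with x∈p∪q⁻ _ _ (terminalAlphabet-++ u v (Equivalence.to InTA⇔∈ x∈TA))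
    ... | inj₁ x∈u = repL-u x (Equivalence.from InTA⇔∈ x∈u)
    ... | inj₂ x∈v = repL-v x (Equivalence.from InTA⇔∈ x∈v)

proposition1 : (n : ℕ) (ϑ : CommRel n) (B : Subset n) →
    Submonoid (RepL ϑ B) × Regular (RepL ϑ B)
proposition1 n ϑ B =
    (RepL-[] ϑ B , RepL-++ ϑ B)
  , regular-viaSubsetAutomaton ⊥ (appendTerminal ϑ) (_⊆? ∁ B) (RepL⇔⊆∁ ϑ B)
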